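{- Let $q$ be a prime power, $k$ an integer, and let $C$ be a cover of $PG(3,q)$ consisting of $r=kq$ points and $s=q(q+1-k)$ planes. Suppose $P$ is a plane containing at least $q+1$ points of $C$. Then the number of lines not contained in $P$ that are incident with at least one point of $C$ is at most $kq^3$.
   Context: $PG(v-1,q)$ is the projective space whose points, lines and planes are the $1$-, $2$- and $3$-dimensional subspaces of $GF(q)^v$; incidence is containment. A cover of $PG(v-1,q)$ is a set of points and planes such that every line is incident with at least one of these points or planes. -}

module Defs where

open import Level using (0ℓ)
open import Data.Nat using (ℕ; zero; suc)
open import Data.Fin using (Fin; zero; suc)
open import Data.Product using (Σ; ∃; _×_)
open import Data.Sum using (_⊎_)
open import Data.List using (List)
open import Data.List.Relation.Unary.Any using (Any)
open import Data.List.Relation.Unary.AllPairs using (AllPairs)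
open import Relation.Binary.PropositionalEquality using (_≡_)
open import Relation.Nullary using (¬_)
open import Algebra.Structures using (IsCommutativeRing)

-- A finite field of order q, realised on the carrier Fin q with
-- propositional equality.  (Every finite field of order q is isomorphic
-- to one of these, and such a structure exists iff q is a prime power.)
record FiniteField (q : ℕ) : Set where
  infixl 6 _+_
  infixl 7 _*_
  field
    _+_ _*_ : Fin q → Fin q → Fin q
    -_      : Fin q → Fin q
    0# 1#   : Fin q
    isCommutativeRing : IsCommutativeRing _≡_ _+_ _*_ -_ 0# 1#
    0≢1     : ¬ (0# ≡ 1#)
    inverse : ∀ x → ¬ (x ≡ 0#) → ∃ λ y → x * y ≡ 1#

module PG3 {q : ℕ} (F : FiniteField q) where
  open FiniteField F

  V : Set
  V = Fin 4 → Fin q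

  lincomb : ∀ {d} → (Fin d → Fin q) → (Fin d → V) → V
  lincomb {zero}  c b j = 0#
  lincomb {suc d} c b j = (c zero * b zero j) + lincomb (λ i → c (suc i)) (λ i → b (suc i)) j

  LinIndep : ∀ {d} → (Fin d → V) → Set
  LinIndep {d} b = ∀ (c : Fin d → Fin q) → (∀ j → lincomb c b j ≡ 0#) → ∀ i → c i ≡ 0#

  record Subspace (d : ℕ) : Set where
    constructor ⟨_,_⟩
    field
      basis : Fin d → V
      indep : LinIndep basis

  _∈ₛ_ : ∀ {d} → V → Subspace d → Set
  v ∈ₛ S = ∃ λ (c : Fin _ → Fin q) → ∀ j → v j ≡ lincomb c (Subspace.basis S) j

  -- containment of subspaces (= incidence in PG(3,q))
  _⊆ₛ_ : ∀ {d e} → Subspace d → Subspace e → Set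
  S ⊆ₛ T = ∀ v → v ∈ₛ S → v ∈ₛ T

  _≐_ : ∀ {d} → Subspace d → Subspace d → Set
  S ≐ T = (S ⊆ₛ T) × (T ⊆ₛ S)

  Point Line Plane : Set
  Point = Subspace 1
  Line  = Subspace 2
  Plane = Subspace 3

  Distinct : ∀ {d} → List (Subspace d) → Set
  Distinct = AllPairs (λ S T → ¬ (S ≐ T))

  IsCover : List Point → List Plane → Set
  IsCover pts pls = ∀ (ℓ : Line) → Any (λ p → p ⊆ₛ ℓ) pts ⊎ Any (λ π → ℓ ⊆ₛ π) pls

module Submission where

-- Let D be the set of points of pts lying in P. Since |D| ≥ q + 1 and P has
-- q² + q + 1 points, at most q² points of P lie outside D. Every line ℓ ⊄ P
-- through a point of pts is charged to a point of pts: to a point of D on ℓ if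
-- there is one (a point of P lies on exactly q² lines not in P), and otherwise
-- to any point p ∉ P of pts on ℓ, in which case ℓ is the join of p with a
-- point of P outside D (at most q² choices). Hence there are at most
-- |pts| · q² = kq³ such lines.

open import Defs
open import Level using (0ℓ)
open import Algebra.Bundles using (CommutativeRing)
open import Data.Nat using (ℕ; zero; suc; _^_; _≤_; z≤n; s≤s)
import Data.Nat as ℕ
open import Data.Nat.Properties using (≤-trans; ≤-reflexive)
open import Data.Fin using (Fin; zero; suc; punchIn)
open import Data.Fin.Properties using (any?; all?; ¬∀⟶∃¬)
import Data.Fin.Properties as Fin
open import Data.Vec.Functional using (Vector; []; _∷_; tail; insertAt; removeAt)
open import Data.Vec.Functional.Properties using (insertAt-lookup; insertAt-punchIn; insertAt-removeAt)
import Data.List as List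
open import Data.List using (List; [_]; length; map; _++_; filter; concatMap; allFin; cartesianProductWith)
open import Data.List.Properties using (length-map; length-++; length-tabulate; length-removeAt′)
open import Data.List.Membership.Propositional using (find; lose)
open import Data.List.Membership.Propositional.Properties using (∈-allFin; ∈-filter⁺)
open import Data.List.Relation.Unary.Any as Any using (Any; here; there; _─_; index)
open import Data.List.Relation.Unary.Any.Properties using (map⁺; ++⁺ˡ; ++⁺ʳ; concatMap⁺; cartesianProductWith⁺)
open import Data.List.Relation.Unary.All as All using (All)
open import Data.List.Relation.Unary.AllPairs using (AllPairs)
open import Data.Product using (∃; _×_; _,_; proj₁; proj₂)
open import Data.Sum using (_⊎_; inj₁; inj₂)
open import Data.Empty using (⊥-elim)
open import Function using (_∘_; id)
open import Relation.Nullary using (¬_; Dec; yes; no)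
open import Relation.Nullary.Decidable using (¬?; map′; _×-dec_)
open import Relation.Unary using (Decidable)
open import Relation.Unary.Properties using (∁?)
open import Relation.Binary.PropositionalEquality
  using (_≡_; _≢_; _≗_; refl; sym; trans; cong; cong₂; subst; module ≡-Reasoning)

module Lists where
  open import Data.Nat using (_+_; _*_)
  open import Data.Nat.Properties using (+-suc; +-mono-≤)
  open ≡-Reasoning

  length-cartesianProductWith : ∀ {A B C : Set} (f : A → B → C) (xs : List A) (ys : List B) →
                                length (cartesianProductWith f xs ys) ≡ length xs * length ys
  length-cartesianProductWith f List.[] ys = refl
  length-cartesianProductWith f (x List.∷ xs) ys = begin
    length (map (f x) ys ++ cartesianProductWith f xs ys)        ≡⟨ length-++ (map (f x) ys) ⟩
    length (map (f x) ys) + length (cartesianProductWith f xs ys) ≡⟨ cong₂ _+_ (length-map (f x) ys)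
                                                                       (length-cartesianProductWith f xs ys) ⟩
    length ys + length xs * length ys                             ∎

  length-concatMap-≤ : ∀ {A B : Set} (f : A → List B) {k} → (∀ x → length (f x) ≤ k) →
                       ∀ xs → length (concatMap f xs) ≤ length xs * k
  length-concatMap-≤ f f≤k List.[] = z≤n
  length-concatMap-≤ f f≤k (x List.∷ xs) =
    ≤-trans (≤-reflexive (length-++ (f x))) (+-mono-≤ (f≤k x) (length-concatMap-≤ f f≤k xs))

  module _ {A : Set} {P : A → Set} (P? : Decidable P) where

    length-filter+length-filter-∁ : ∀ xs → length (filter P? xs) + length (filter (∁? P?) xs) ≡ length xs
    length-filter+length-filter-∁ List.[] = refl
    length-filter+length-filter-∁ (x List.∷ xs) with P? x
    ... | yes _ = cong suc (length-filter+length-filter-∁ xs)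
    ... | no _ = trans (+-suc _ _) (cong suc (length-filter+length-filter-∁ xs))

    any-filter⁺ : ∀ {Q : A → Set} {xs} → Any (λ x → Q x × P x) xs → Any Q (filter P? xs)
    any-filter⁺ any with find any
    ... | x , x∈xs , (qx , px) = lose (∈-filter⁺ P? x∈xs px) qx

  ─⁺ : ∀ {A : Set} {P Q : A → Set} {ys} (p : Any P ys) → Any Q ys → (∀ {y} → P y → ¬ Q y) → Any Q (ys ─ p)
  ─⁺ (here py) (here qy) P⇒¬Q = ⊥-elim (P⇒¬Q py qy)
  ─⁺ (here py) (there q) P⇒¬Q = q
  ─⁺ (there p) (here qy) P⇒¬Q = here qy
  ─⁺ (there p) (there q) P⇒¬Q = there (─⁺ p q P⇒¬Q)

  module _ {A B : Set} {_≈_ : A → A → Set} (R : A → B → Set)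
           (witness-determines : ∀ {a a′ b} → R a b → R a′ b → a ≈ a′) where

    distinct-witnessed⇒length≤ : ∀ {xs} → AllPairs (λ a a′ → ¬ a ≈ a′) xs →
                                 ∀ ys → All (λ a → Any (R a) ys) xs → length xs ≤ length ys
    distinct-witnessed⇒length≤ AllPairs.[] ys All.[] = z≤n
    distinct-witnessed⇒length≤ (x≉xs AllPairs.∷ distinct) ys (x∈ys All.∷ xs∈ys) =
      subst (suc _ ≤_) (sym (length-removeAt′ ys (index x∈ys)))
        (s≤s (distinct-witnessed⇒length≤ distinct (ys ─ x∈ys) (All.zipWith witness-survives (x≉xs , xs∈ys))))
      where
      witness-survives : ∀ {y} → ¬ _ ≈ y × Any (R y) ys → Any (R y) (ys ─ x∈ys)
      witness-survives (x≉y , y∈ys) = ─⁺ x∈ys y∈ys (λ Rxb Ryb → x≉y (witness-determines Rxb Ryb))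

open Lists

insertAt-cong : ∀ {A : Set} {n} {u v : Vector A n} → u ≗ v → ∀ i x → insertAt u i x ≗ insertAt v i x
insertAt-cong u≗v zero x zero = refl
insertAt-cong u≗v zero x (suc j) = u≗v j
insertAt-cong {n = suc n} u≗v (suc i) x zero = u≗v zero
insertAt-cong {n = suc n} u≗v (suc i) x (suc j) = insertAt-cong (u≗v ∘ suc) i x j

module LinearAlgebra {q : ℕ} (F : FiniteField q) where
  open FiniteField F

  commutativeRing : CommutativeRing 0ℓ 0ℓ
  commutativeRing = record { isCommutativeRing = isCommutativeRing }

  open CommutativeRing commutativeRing
    using (+-identityˡ; +-identityʳ; *-identityˡ; *-identityʳ; zeroˡ; zeroʳ;
           -‿inverseˡ; -‿inverseʳ; +-comm; +-assoc; *-comm; *-assoc; distribˡ; distribʳ; ring; semiring)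
  open import Algebra.Properties.Ring ring
    using (-0#≈0#; -‿injective; -‿involutive; -‿distribˡ-*; -‿distribʳ-*; -1*x≈-x; +-inverseˡ-unique)
  open import Algebra.Properties.Semiring.Sum semiring
    using (sum; sum-cong-≗; sum-remove; ∑-distrib-+; ∑-comm; *-distribˡ-sum; *-distribʳ-sum; sum-replicate-zero)
  open ≡-Reasoning

  K : Set
  K = Fin q

  _≟_ : (x y : K) → Dec (x ≡ y)
  _≟_ = Fin._≟_

  infix 9 _⁻¹
  _⁻¹ : ∀ {x} → x ≢ 0# → K
  nz ⁻¹ = proj₁ (inverse _ nz)

  x⁻¹*x≡1 : ∀ {x} (nz : x ≢ 0#) → nz ⁻¹ * x ≡ 1#
  x⁻¹*x≡1 {x} nz = trans (*-comm _ x) (proj₂ (inverse x nz))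

  x⁻¹*[x*y]≡y : ∀ {x} (nz : x ≢ 0#) y → nz ⁻¹ * (x * y) ≡ y
  x⁻¹*[x*y]≡y {x} nz y = begin
    nz ⁻¹ * (x * y)   ≡⟨ *-assoc _ x y ⟨
    nz ⁻¹ * x * y     ≡⟨ cong (_* y) (x⁻¹*x≡1 nz) ⟩
    1# * y            ≡⟨ *-identityˡ y ⟩
    y                 ∎

  x*[x⁻¹*y]≡y : ∀ {x} (nz : x ≢ 0#) y → x * (nz ⁻¹ * y) ≡ y
  x*[x⁻¹*y]≡y {x} nz y = begin
    x * (nz ⁻¹ * y)   ≡⟨ *-assoc x _ y ⟨
    x * nz ⁻¹ * y     ≡⟨ cong (_* y) (proj₂ (inverse x nz)) ⟩
    1# * y            ≡⟨ *-identityˡ y ⟩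
    y                 ∎

  x+y-y≡x : ∀ x y → x + y + - y ≡ x
  x+y-y≡x x y = trans (+-assoc x y (- y)) (trans (cong (x +_) (-‿inverseʳ y)) (+-identityʳ x))

  1≢0 : 1# ≢ 0#
  1≢0 = 0≢1 ∘ sym

  *-cancel-nonzero : ∀ {x y} → x ≢ 0# → x * y ≡ 0# → y ≡ 0#
  *-cancel-nonzero {x} {y} nz xy≡0 = begin
    y                 ≡⟨ x⁻¹*[x*y]≡y nz y ⟨
    nz ⁻¹ * (x * y)   ≡⟨ cong (nz ⁻¹ *_) xy≡0 ⟩
    nz ⁻¹ * 0#        ≡⟨ zeroʳ _ ⟩
    0#                ∎

  -x≡0⇒x≡0 : ∀ {x} → - x ≡ 0# → x ≡ 0#
  -x≡0⇒x≡0 -x≡0 = -‿injective (trans -x≡0 (sym -0#≈0#))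

  sum-neg : ∀ {m} (f : Vector K m) → - sum f ≡ sum (λ i → - f i)
  sum-neg f = begin
    - sum f                     ≡⟨ -1*x≈-x (sum f) ⟨
    - 1# * sum f                ≡⟨ *-distribˡ-sum (- 1#) f ⟩
    sum (λ i → - 1# * f i)      ≡⟨ sum-cong-≗ (λ i → -1*x≈-x (f i)) ⟩
    sum (λ i → - f i)           ∎

  0v : ∀ {n} → Vector K n
  0v _ = 0#

  infixr 5 _·_
  _·_ : ∀ {n} → K → Vector K n → Vector K n
  (a · v) j = a * v j

  Nontrivial : ∀ {n} → Vector K n → Set
  Nontrivial c = ∃ λ i → c i ≢ 0#

  nontrivial? : ∀ {n} (c : Vector K n) → Dec (Nontrivial c)
  nontrivial? c = any? (λ i → ¬? (c i ≟ 0#))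

  trivial : ∀ {n} {c : Vector K n} → ¬ Nontrivial c → c ≗ 0v
  trivial {c = c} triv i with c i ≟ 0#
  ... | yes ci≡0 = ci≡0
  ... | no ci≢0 = ⊥-elim (triv (i , ci≢0))

  lc : ∀ {m n} → Vector K m → (Fin m → Vector K n) → Vector K n
  lc c w j = sum (λ i → c i * w i j)

  lc-congˡ : ∀ {m n} {c d : Vector K m} (w : Fin m → Vector K n) → c ≗ d → lc c w ≗ lc d w
  lc-congˡ w c≗d j = sum-cong-≗ (λ i → cong (_* w i j) (c≗d i))

  lc-congʳ : ∀ {m n} (c : Vector K m) {v w : Fin m → Vector K n} → (∀ i → v i ≗ w i) → lc c v ≗ lc c w
  lc-congʳ c v≗w j = sum-cong-≗ (λ i → cong (c i *_) (v≗w i j))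

  lc-zeroˡ : ∀ {m n} (w : Fin m → Vector K n) → lc 0v w ≗ 0v
  lc-zeroˡ {m} w j = trans (sum-cong-≗ (λ i → zeroˡ (w i j))) (sum-replicate-zero m)

  lc-scale : ∀ {m n} x (c : Vector K m) (w : Fin m → Vector K n) → lc (x · c) w ≗ x · lc c w
  lc-scale x c w j = begin
    sum (λ i → x * c i * w i j)     ≡⟨ sum-cong-≗ (λ i → *-assoc x (c i) (w i j)) ⟩
    sum (λ i → x * (c i * w i j))   ≡⟨ *-distribˡ-sum x (λ i → c i * w i j) ⟨
    x * lc c w j                    ∎

  lc-neg : ∀ {m n} (c : Vector K m) (w : Fin m → Vector K n) → lc (λ i → - c i) w ≗ (λ j → - lc c w j)
  lc-neg c w j = begin
    sum (λ i → - c i * w i j)       ≡⟨ sum-cong-≗ (λ i → -‿distribˡ-* (c i) (w i j)) ⟨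
    sum (λ i → - (c i * w i j))     ≡⟨ sum-neg (λ i → c i * w i j) ⟨
    - lc c w j                      ∎

  lc-+ : ∀ {m n} (c d : Vector K m) (w : Fin m → Vector K n) →
         lc (λ i → c i + d i) w ≗ (λ j → lc c w j + lc d w j)
  lc-+ c d w j =
    trans (sum-cong-≗ (λ i → distribʳ (w i j) (c i) (d i))) (∑-distrib-+ (λ i → c i * w i j) (λ i → d i * w i j))

  lc-∘ : ∀ {m r n} (c : Vector K m) (A : Fin m → Vector K r) (u : Fin r → Vector K n) →
         lc c (λ i → lc (A i) u) ≗ lc (lc c A) u
  lc-∘ c A u j = begin
    sum (λ i → c i * sum (λ k → A i k * u k j))     ≡⟨ sum-cong-≗ (λ i → *-distribˡ-sum (c i) (λ k → A i k * u k j)) ⟩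
    sum (λ i → sum (λ k → c i * (A i k * u k j)))   ≡⟨ ∑-comm (λ i k → c i * (A i k * u k j)) ⟩
    sum (λ k → sum (λ i → c i * (A i k * u k j)))   ≡⟨ sum-cong-≗ (λ k → sum-cong-≗ (λ i → *-assoc (c i) (A i k) (u k j))) ⟨
    sum (λ k → sum (λ i → c i * A i k * u k j))     ≡⟨ sum-cong-≗ (λ k → *-distribʳ-sum (u k j) (λ i → c i * A i k)) ⟨
    sum (λ k → lc c A k * u k j)                    ∎

  lc-zeroʳ : ∀ {m n} (c : Vector K m) (w : Fin m → Vector K n) j → (∀ i → w i j ≡ 0#) → lc c w j ≡ 0#
  lc-zeroʳ {m} c w j wj≡0 =
    trans (sum-cong-≗ (λ i → trans (cong (c i *_) (wj≡0 i)) (zeroʳ (c i)))) (sum-replicate-zero m)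

  lc-tail : ∀ {m n} (c : Vector K (suc m)) (w : Fin (suc m) → Vector K n) →
            c zero ≡ 0# → lc c w ≗ lc (tail c) (tail w)
  lc-tail c w c₀≡0 j = begin
    c zero * w zero j + lc (tail c) (tail w) j   ≡⟨ cong (λ x → x * w zero j + lc (tail c) (tail w) j) c₀≡0 ⟩
    0# * w zero j + lc (tail c) (tail w) j       ≡⟨ cong (_+ lc (tail c) (tail w) j) (zeroˡ (w zero j)) ⟩
    0# + lc (tail c) (tail w) j                  ≡⟨ +-identityˡ _ ⟩
    lc (tail c) (tail w) j                       ∎

  eliminate : ∀ {m n} → (Fin (suc m) → Vector K n) → Fin (suc m) → Vector K m → Fin m → Vector K n
  eliminate w i₀ μ k j = w (punchIn i₀ k) j + - (μ k * w i₀ j)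

  lc-eliminate : ∀ {m n} (w : Fin (suc m) → Vector K n) (i₀ : Fin (suc m)) (μ c : Vector K m) →
                 lc (insertAt c i₀ (- sum (λ k → c k * μ k))) w ≗ lc c (eliminate w i₀ μ)
  lc-eliminate w i₀ μ c j = begin
    sum (λ i → c′ i * w i j)
      ≡⟨ sum-remove {i = i₀} (λ i → c′ i * w i j) ⟩
    c′ i₀ * w i₀ j + sum (λ k → c′ (punchIn i₀ k) * w (punchIn i₀ k) j)
      ≡⟨ cong₂ _+_ (cong (_* w i₀ j) (insertAt-lookup c i₀ x))
                   (sum-cong-≗ (λ k → cong (_* w (punchIn i₀ k) j) (insertAt-punchIn c i₀ x k))) ⟩
    x * w i₀ j + sum (λ k → c k * w (punchIn i₀ k) j)
      ≡⟨ +-comm _ _ ⟩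
    sum (λ k → c k * w (punchIn i₀ k) j) + x * w i₀ j
      ≡⟨ cong (sum (λ k → c k * w (punchIn i₀ k) j) +_) pivot-term ⟩
    sum (λ k → c k * w (punchIn i₀ k) j) + sum (λ k → c k * - (μ k * w i₀ j))
      ≡⟨ ∑-distrib-+ (λ k → c k * w (punchIn i₀ k) j) (λ k → c k * - (μ k * w i₀ j)) ⟨
    sum (λ k → c k * w (punchIn i₀ k) j + c k * - (μ k * w i₀ j))
      ≡⟨ sum-cong-≗ (λ k → distribˡ (c k) _ _) ⟨
    sum (λ k → c k * (w (punchIn i₀ k) j + - (μ k * w i₀ j)))   ∎
    where
    x = - sum (λ k → c k * μ k)
    c′ = insertAt c i₀ x
    pivot-term : x * w i₀ j ≡ sum (λ k → c k * - (μ k * w i₀ j))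
    pivot-term = begin
      x * w i₀ j                               ≡⟨ -‿distribˡ-* _ (w i₀ j) ⟨
      - (sum (λ k → c k * μ k) * w i₀ j)       ≡⟨ cong -_ (*-distribʳ-sum (w i₀ j) (λ k → c k * μ k)) ⟩
      - sum (λ k → c k * μ k * w i₀ j)         ≡⟨ sum-neg (λ k → c k * μ k * w i₀ j) ⟩
      sum (λ k → - (c k * μ k * w i₀ j))       ≡⟨ sum-cong-≗ (λ k → trans (cong -_ (*-assoc (c k) (μ k) (w i₀ j)))
                                                                        (-‿distribʳ-* (c k) (μ k * w i₀ j))) ⟩
      sum (λ k → c k * - (μ k * w i₀ j))       ∎

  pivot : ∀ {m n} (w : Fin (suc m) → Vector K (suc n)) →
          ∃ λ i₀ → ∃ λ (μ : Vector K m) → ∀ k → w (punchIn i₀ k) zero ≡ μ k * w i₀ zero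
  pivot w with nontrivial? (λ i → w i zero)
  ... | yes (i₀ , a≢0) = i₀ , (λ k → w (punchIn i₀ k) zero * a≢0 ⁻¹) , λ k → begin
    w (punchIn i₀ k) zero                            ≡⟨ x*[x⁻¹*y]≡y a≢0 _ ⟨
    w i₀ zero * (a≢0 ⁻¹ * w (punchIn i₀ k) zero)     ≡⟨ *-comm _ _ ⟩
    a≢0 ⁻¹ * w (punchIn i₀ k) zero * w i₀ zero       ≡⟨ cong (_* w i₀ zero) (*-comm _ _) ⟩
    w (punchIn i₀ k) zero * a≢0 ⁻¹ * w i₀ zero       ∎
  ... | no allZero = zero , 0v , λ k → trans (trivial allZero (suc k)) (sym (zeroˡ _))

  Dependent : ∀ {m n} → (Fin m → Vector K n) → Set
  Dependent w = ∃ λ c → Nontrivial c × lc c w ≗ 0v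

  -- Gaussian elimination: clear the first coordinate against a pivot, find a
  -- dependency among the remaining coordinates of the other vectors, and lift it
  -- back with lc-eliminate.
  dependent : ∀ n (w : Fin (suc n) → Vector K n) → Dependent w
  dependent zero w = (λ _ → 1#) , (zero , 1≢0) , λ ()
  dependent (suc n) w with pivot w
  ... | i₀ , μ , first≡μ*pivot with dependent n (λ k → tail (eliminate w i₀ μ k))
  ...   | c , (k , ck≢0) , lc≡0 =
    insertAt c i₀ x , (punchIn i₀ k , λ e → ck≢0 (trans (sym (insertAt-punchIn c i₀ x k)) e)) ,
    λ j → trans (lc-eliminate w i₀ μ c j) (reduced-lc≡0 j)
    where
    x = - sum (λ k → c k * μ k)
    reduced-lc≡0 : lc c (eliminate w i₀ μ) ≗ 0v
    reduced-lc≡0 zero = lc-zeroʳ c (eliminate w i₀ μ) zero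
      (λ k → trans (cong (_+ - (μ k * w i₀ zero)) (first≡μ*pivot k)) (-‿inverseʳ _))
    reduced-lc≡0 (suc j) = lc≡0 j

  _∈span_ : ∀ {m n} → Vector K n → (Fin m → Vector K n) → Set
  v ∈span w = ∃ λ c → v ≗ lc c w

  Independent : ∀ {m n} → (Fin m → Vector K n) → Set
  Independent w = ∀ c → lc c w ≗ 0v → c ≗ 0v

  ∈span-resp-≗ : ∀ {m n} {u v : Vector K n} {w : Fin m → Vector K n} → u ≗ v → u ∈span w → v ∈span w
  ∈span-resp-≗ u≗v (c , u≗lc) = c , λ j → trans (sym (u≗v j)) (u≗lc j)

  ∈span-scale : ∀ {m n} {v : Vector K n} {w : Fin m → Vector K n} a → v ∈span w → (a · v) ∈span w
  ∈span-scale {w = w} a (c , v≗lc) = a · c , λ j → trans (cong (a *_) (v≗lc j)) (sym (lc-scale a c w j))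

  ∈span-+ : ∀ {m n} {u v : Vector K n} {w : Fin m → Vector K n} →
            u ∈span w → v ∈span w → (λ j → u j + v j) ∈span w
  ∈span-+ {w = w} (c , u≗lc) (d , v≗lc) =
    (λ i → c i + d i) , λ j → trans (cong₂ _+_ (u≗lc j) (v≗lc j)) (sym (lc-+ c d w j))

  ∈span-member : ∀ {m n} (w : Fin m → Vector K n) i → w i ∈span w
  ∈span-member w zero = 1# ∷ 0v , λ j → sym (begin
    1# * w zero j + lc 0v (tail w) j   ≡⟨ cong₂ _+_ (*-identityˡ _) (lc-zeroˡ (tail w) j) ⟩
    w zero j + 0#                      ≡⟨ +-identityʳ _ ⟩
    w zero j                           ∎)
  ∈span-member w (suc i) with ∈span-member (tail w) i
  ... | c , wi≗lc = 0# ∷ c , λ j → trans (wi≗lc j) (sym (lc-tail (0# ∷ c) w refl j))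

  ∈span-trans : ∀ {l m n} {v : Vector K n} {u : Fin l → Vector K n} {w : Fin m → Vector K n} →
                v ∈span u → (∀ i → u i ∈span w) → v ∈span w
  ∈span-trans {u = u} {w} (c , v≗lc) u⊆w =
    lc c (λ i → proj₁ (u⊆w i)) , λ j → begin
      _                                       ≡⟨ v≗lc j ⟩
      lc c u j                                ≡⟨ lc-congʳ c (λ i → proj₂ (u⊆w i)) j ⟩
      lc c (λ i → lc (proj₁ (u⊆w i)) w) j     ≡⟨ lc-∘ c (λ i → proj₁ (u⊆w i)) w j ⟩
      lc (lc c (λ i → proj₁ (u⊆w i))) w j     ∎

  head-∈span-tail : ∀ {m n} (c : Vector K (suc m)) (w : Fin (suc m) → Vector K n) →
                    lc c w ≗ 0v → c zero ≢ 0# → w zero ∈span tail w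
  head-∈span-tail c w lc≡0 c₀≢0 = (λ i → - (c₀≢0 ⁻¹) * c (suc i)) , λ j → begin
    w zero j                                    ≡⟨ x⁻¹*[x*y]≡y c₀≢0 (w zero j) ⟨
    c₀≢0 ⁻¹ * (c zero * w zero j)               ≡⟨ cong (c₀≢0 ⁻¹ *_) (+-inverseˡ-unique _ _ (lc≡0 j)) ⟩
    c₀≢0 ⁻¹ * - lc (tail c) (tail w) j          ≡⟨ -‿distribʳ-* _ _ ⟨
    - (c₀≢0 ⁻¹ * lc (tail c) (tail w) j)        ≡⟨ -‿distribˡ-* _ _ ⟩
    - (c₀≢0 ⁻¹) * lc (tail c) (tail w) j        ≡⟨ lc-scale (- (c₀≢0 ⁻¹)) (tail c) (tail w) j ⟨
    lc (λ i → - (c₀≢0 ⁻¹) * c (suc i)) (tail w) j   ∎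

  ∈span-if-dependent-∷ : ∀ {m n} {v : Vector K n} {w : Fin m → Vector K n} →
                         Independent w → Dependent (v ∷ w) → v ∈span w
  ∈span-if-dependent-∷ {v = v} {w} ind (c , (i , cᵢ≢0) , lc≡0) with c zero ≟ 0#
  ... | no c₀≢0 = head-∈span-tail c (v ∷ w) lc≡0 c₀≢0
  ... | yes c₀≡0 = ⊥-elim (cᵢ≢0 (c≗0 i))
    where
    c≗0 : c ≗ 0v
    c≗0 zero = c₀≡0
    c≗0 (suc i) = ind (tail c) (λ j → trans (sym (lc-tail c (v ∷ w) c₀≡0 j)) (lc≡0 j)) i

  independent-∷ : ∀ {m n} {v : Vector K n} {w : Fin m → Vector K n} →
                  Independent w → ¬ v ∈span w → Independent (v ∷ w)
  independent-∷ {v = v} {w} ind v∉w c lc≡0 with c zero ≟ 0#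
  ... | no c₀≢0 = ⊥-elim (v∉w (head-∈span-tail c (v ∷ w) lc≡0 c₀≢0))
  ... | yes c₀≡0 = λ where
    zero → c₀≡0
    (suc i) → ind (tail c) (λ j → trans (sym (lc-tail c (v ∷ w) c₀≡0 j)) (lc≡0 j)) i

  lc-∷-∷-≗0 : ∀ {m n} (c : Vector K (suc (suc m))) (u v : Vector K n) (w : Fin m → Vector K n) →
              lc c (u ∷ v ∷ w) ≗ 0v →
              lc (λ i → - c (suc (suc i))) w ≗ lc (c zero ∷ c (suc zero) ∷ []) (u ∷ v ∷ [])
  lc-∷-∷-≗0 c u v w lc≡0 j = begin
    lc (λ i → - c (suc (suc i))) w j            ≡⟨ lc-neg (tail (tail c)) w j ⟩
    - lc (tail (tail c)) w j                    ≡⟨ +-inverseˡ-unique _ _ (trans (+-assoc _ _ _) (lc≡0 j)) ⟨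
    c zero * u j + c (suc zero) * v j           ≡⟨ cong (c zero * u j +_) (+-identityʳ _) ⟨
    c zero * u j + (c (suc zero) * v j + 0#)    ∎

  dependent-∷-∷ : ∀ {m n} {u v : Vector K n} {w : Fin m → Vector K n} →
                  Independent (u ∷ v ∷ []) → Dependent (u ∷ v ∷ w) →
                  ∃ λ γ → Nontrivial γ × lc γ w ∈span (u ∷ v ∷ [])
  dependent-∷-∷ {u = u} {v} {w} ind (c , nt , lc≡0) = γ , nontrivial-γ , d , γ-in-uv
    where
    γ = λ i → - c (suc (suc i))
    d = c zero ∷ c (suc zero) ∷ []
    γ-in-uv : lc γ w ≗ lc d (u ∷ v ∷ [])
    γ-in-uv = lc-∷-∷-≗0 c u v w lc≡0
    nontrivial-γ : Nontrivial γ
    nontrivial-γ with nontrivial? γ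
    ... | yes γ-nontrivial = γ-nontrivial
    ... | no γ-trivial = ⊥-elim (proj₂ nt (c≗0 (proj₁ nt)))
      where
      d≗0 : d ≗ 0v
      d≗0 = ind d (λ j → trans (sym (γ-in-uv j)) (trans (lc-congˡ w (trivial γ-trivial) j) (lc-zeroˡ w j)))
      c≗0 : c ≗ 0v
      c≗0 zero = d≗0 zero
      c≗0 (suc zero) = d≗0 (suc zero)
      c≗0 (suc (suc i)) = -x≡0⇒x≡0 (trivial γ-trivial i)

  lc-injective : ∀ {m n} {w : Fin m → Vector K n} → Independent w → ∀ {c d} → lc c w ≗ lc d w → c ≗ d
  lc-injective {w = w} ind {c} {d} c≗d i =
    trans (+-inverseˡ-unique (c i) (- d i) (ind (λ i → c i + - d i) difference≡0 i)) (-‿involutive (d i))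
    where
    difference≡0 : lc (λ i → c i + - d i) w ≗ 0v
    difference≡0 j = begin
      lc (λ i → c i + - d i) w j                 ≡⟨ lc-+ c (λ i → - d i) w j ⟩
      lc c w j + lc (λ i → - d i) w j            ≡⟨ cong₂ _+_ (c≗d j) (lc-neg d w j) ⟩
      lc d w j + - lc d w j                      ≡⟨ -‿inverseʳ _ ⟩
      0#                                         ∎

  independent-[-]⇒≢0 : ∀ {n} {u : Vector K n} → Independent (u ∷ []) → ¬ u ≗ 0v
  independent-[-]⇒≢0 {u = u} ind u≗0 =
    1≢0 (ind (λ _ → 1#) (λ j → trans (cong (_+ 0#) (trans (*-identityˡ (u j)) (u≗0 j))) (+-identityʳ 0#)) zero)

  nontrivial-if-combination : ∀ {m n} {u : Vector K n} {c : Vector K m} (w : Fin m → Vector K n) →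
                              Independent (u ∷ []) → u ≗ lc c w → Nontrivial c
  nontrivial-if-combination {c = c} w ind u≗lc with nontrivial? c
  ... | yes nt = nt
  ... | no triv =
    ⊥-elim (independent-[-]⇒≢0 ind (λ j → trans (u≗lc j) (trans (lc-congˡ w (trivial triv) j) (lc-zeroˡ w j))))

  ∈span-[-]-sym : ∀ {n} {u v : Vector K n} → Independent (u ∷ []) → u ∈span (v ∷ []) → v ∈span (u ∷ [])
  ∈span-[-]-sym {u = u} {v} ind (c , u≗cv) with nontrivial-if-combination {u = u} {c = c} (v ∷ []) ind u≗cv
  ... | zero , c₀≢0 = (λ _ → c₀≢0 ⁻¹) , λ j → begin
    v j                            ≡⟨ x⁻¹*[x*y]≡y c₀≢0 (v j) ⟨
    c₀≢0 ⁻¹ * (c zero * v j)       ≡⟨ cong (c₀≢0 ⁻¹ *_) (trans (sym (+-identityʳ _)) (sym (u≗cv j))) ⟩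
    c₀≢0 ⁻¹ * u j                  ≡⟨ +-identityʳ _ ⟨
    c₀≢0 ⁻¹ * u j + 0#             ∎

  independent-lc : ∀ {m n} {w : Fin m → Vector K n} {κ : Vector K m} →
                   Independent w → Nontrivial κ → Independent (lc κ w ∷ [])
  independent-lc {w = w} {κ} ind (i , κᵢ≢0) c lc≡0 zero =
    *-cancel-nonzero κᵢ≢0 (trans (*-comm (κ i) (c zero)) (ind (c zero · κ) cκ≡0 i))
    where
    cκ≡0 : lc (c zero · κ) w ≗ 0v
    cκ≡0 j = trans (lc-scale (c zero) κ w j) (trans (sym (+-identityʳ _)) (lc≡0 j))

  independent-pair : ∀ {m n} {b : Fin m → Vector K n} {v w : Vector K n} →
                     ¬ v ∈span b → w ∈span b → Independent (w ∷ []) → Independent (v ∷ w ∷ [])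
  independent-pair {b = b} {w = w} v∉b w∈b ind =
    independent-∷ {w = w ∷ []} ind (λ v∈w → v∉b (∈span-trans {u = w ∷ []} {w = b} v∈w λ { zero → w∈b }))

  independent-spans : ∀ {n} {w : Fin n → Vector K n} → Independent w → ∀ v → v ∈span w
  independent-spans {n} {w} ind v = ∈span-if-dependent-∷ ind (dependent n (v ∷ w))

  independent-span-⊇ : ∀ {d n} {u w : Fin d → Vector K n} {v : Vector K n} →
                       Independent w → (∀ i → w i ∈span u) → v ∈span u → v ∈span w
  independent-span-⊇ {d} {u = u} {w} {v} ind w⊆u (cᵥ , v≗lc) with dependent d (cᵥ ∷ λ i → proj₁ (w⊆u i))
  ... | c , nt , lc≡0 = ∈span-if-dependent-∷ ind (c , nt , λ j → begin
    lc c (v ∷ w) j                           ≡⟨ lc-congʳ c coordinates j ⟩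
    lc c (λ i → lc (coefficients i) u) j     ≡⟨ lc-∘ c coefficients u j ⟩
    lc (lc c coefficients) u j               ≡⟨ lc-congˡ u lc≡0 j ⟩
    lc 0v u j                                ≡⟨ lc-zeroˡ u j ⟩
    0#                                       ∎)
    where
    coefficients : Fin (suc d) → Vector K d
    coefficients = cᵥ ∷ λ i → proj₁ (w⊆u i)
    coordinates : ∀ i → (v ∷ w) i ≗ lc (coefficients i) u
    coordinates zero = v≗lc
    coordinates (suc i) = proj₂ (w⊆u i)

  vectors : ∀ n → List (Vector K n)
  vectors zero = [ [] ]
  vectors (suc n) = cartesianProductWith _∷_ (allFin q) (vectors n)

  length-vectors : ∀ n → length (vectors n) ≡ q ^ n
  length-vectors zero = refl
  length-vectors (suc n) = begin
    length (cartesianProductWith _∷_ (allFin q) (vectors n))  ≡⟨ length-cartesianProductWith _∷_ (allFin q) (vectors n) ⟩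
    length (allFin q) ℕ.* length (vectors n)                  ≡⟨ cong₂ ℕ._*_ (length-tabulate {n = q} id) (length-vectors n) ⟩
    q ℕ.* q ^ n                                               ∎

  ∈-vectors : ∀ {n} (v : Vector K n) → Any (v ≗_) (vectors n)
  ∈-vectors {zero} v = here (λ ())
  ∈-vectors {suc n} v = cartesianProductWith⁺ _∷_ ∷-cong (∈-allFin (v zero)) (∈-vectors (tail v))
    where
    ∷-cong : ∀ {a u} → v zero ≡ a → tail v ≗ u → v ≗ a ∷ u
    ∷-cong v₀≡a _ zero = v₀≡a
    ∷-cong _ tail≗u (suc i) = tail≗u i

  ∈span? : ∀ {m n} (v : Vector K n) (w : Fin m → Vector K n) → Dec (v ∈span w)
  ∈span? {m} v w =
    map′ Any.satisfied (λ (c , v≗lc) → Any.map (λ c≗d j → trans (v≗lc j) (lc-congˡ w c≗d j)) (∈-vectors c))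
         (Any.any? (λ c → all? (λ j → v j ≟ lc c w j)) (vectors m))

  _∝_ : ∀ {n} → Vector K n → Vector K n → Set
  u ∝ v = ∃ λ s → s ≢ 0# × u ≗ s · v

  -- the vectors whose first nonzero coordinate is 1, one for each point of the projective space
  normalized : ∀ n → List (Vector K n)
  normalized zero = List.[]
  normalized (suc n) = map (1# ∷_) (vectors n) ++ map (0# ∷_) (normalized n)

  length-normalized : ∀ n → length (normalized (suc n)) ≡ q ^ n ℕ.+ length (normalized n)
  length-normalized n = begin
    length (map (1# ∷_) (vectors n) ++ map (0# ∷_) (normalized n))
      ≡⟨ length-++ (map (1# ∷_) (vectors n)) ⟩
    length (map (1# ∷_) (vectors n)) ℕ.+ length (map (0# ∷_) (normalized n))
      ≡⟨ cong₂ ℕ._+_ (trans (length-map _ (vectors n)) (length-vectors n)) (length-map _ (normalized n)) ⟩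
    q ^ n ℕ.+ length (normalized n)
      ∎

  normalize : ∀ {n} (γ : Vector K n) → Nontrivial γ → Any (γ ∝_) (normalized n)
  normalize {suc n} γ nt with γ zero ≟ 0#
  ... | no γ₀≢0 = ++⁺ˡ (map⁺ (Any.map ∝-normal (∈-vectors (γ₀≢0 ⁻¹ · tail γ))))
    where
    ∝-normal : ∀ {u} → γ₀≢0 ⁻¹ · tail γ ≗ u → γ ∝ (1# ∷ u)
    ∝-normal scaled≗u = γ zero , γ₀≢0 , λ where
      zero → sym (*-identityʳ _)
      (suc i) → sym (trans (cong (γ zero *_) (sym (scaled≗u i))) (x*[x⁻¹*y]≡y γ₀≢0 _))
  ... | yes γ₀≡0 = ++⁺ʳ _ (map⁺ (Any.map ∝-shift (normalize (tail γ) (tail-nontrivial nt))))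
    where
    tail-nontrivial : Nontrivial γ → Nontrivial (tail γ)
    tail-nontrivial (zero , γ₀≢0) = ⊥-elim (γ₀≢0 γ₀≡0)
    tail-nontrivial (suc i , γᵢ≢0) = i , γᵢ≢0
    ∝-shift : ∀ {u} → tail γ ∝ u → γ ∝ (0# ∷ u)
    ∝-shift (s , s≢0 , tail≗su) = s , s≢0 , λ where
      zero → trans γ₀≡0 (sym (zeroʳ s))
      (suc i) → tail≗su i

  -- a complement of the line spanned by π: the vectors vanishing at a coordinate where π does not
  complement : ∀ {n} (π : Vector K (suc n)) → Nontrivial π → List (Vector K (suc n))
  complement {n} π (i , _) = map (λ u → insertAt u i 0#) (vectors n)

  length-complement : ∀ {n} (π : Vector K (suc n)) (nt : Nontrivial π) → length (complement π nt) ≡ q ^ n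
  length-complement {n} π (i , _) = trans (length-map _ (vectors n)) (length-vectors n)

  complement-covers : ∀ {n} (π : Vector K (suc n)) (nt : Nontrivial π) (β : Vector K (suc n)) →
                      ∃ λ t → Any (λ u → β ≗ (λ j → u j + t * π j)) (complement π nt)
  complement-covers π (i , πᵢ≢0) β = t , map⁺ (Any.map decompose (∈-vectors (removeAt r i)))
    where
    t = πᵢ≢0 ⁻¹ * β i
    r : Vector K _
    r j = β j + - (t * π j)
    rᵢ≡0 : r i ≡ 0#
    rᵢ≡0 = trans (cong (λ x → β i + - x) (trans (*-comm t (π i)) (x*[x⁻¹*y]≡y πᵢ≢0 (β i)))) (-‿inverseʳ (β i))
    r≗ : insertAt (removeAt r i) i 0# ≗ r
    r≗ = subst (λ x → insertAt (removeAt r i) i x ≗ r) rᵢ≡0 (insertAt-removeAt r i)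
    decompose : ∀ {u} → removeAt r i ≗ u → β ≗ (λ j → insertAt u i 0# j + t * π j)
    decompose r≗u j = begin
      β j                                     ≡⟨ +-identityʳ (β j) ⟨
      β j + 0#                                ≡⟨ cong (β j +_) (-‿inverseˡ (t * π j)) ⟨
      β j + (- (t * π j) + t * π j)           ≡⟨ +-assoc (β j) _ _ ⟨
      r j + t * π j                           ≡⟨ cong (_+ t * π j) (trans (sym (r≗ j)) (insertAt-cong r≗u i 0# j)) ⟩
      insertAt _ i 0# j + t * π j             ∎

  ∝-nontrivial : ∀ {n} {γ κ : Vector K n} → γ ∝ κ → Nontrivial γ → Nontrivial κ
  ∝-nontrivial {κ = κ} (s , _ , γ≗sκ) (i , γᵢ≢0) =
    i , λ κᵢ≡0 → γᵢ≢0 (trans (γ≗sκ i) (trans (cong (s *_) κᵢ≡0) (zeroʳ s)))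

  ∝⇒lc-∈span : ∀ {l m n} {γ κ : Vector K m} {w : Fin m → Vector K n} {u : Fin l → Vector K n} →
               γ ∝ κ → lc γ w ∈span u → lc κ w ∈span u
  ∝⇒lc-∈span {κ = κ} {w} (s , s≢0 , γ≗sκ) γ∈u = ∈span-resp-≗ rescale (∈span-scale (s≢0 ⁻¹) γ∈u)
    where
    rescale : s≢0 ⁻¹ · lc _ w ≗ lc κ w
    rescale j = trans (cong (s≢0 ⁻¹ *_) (trans (lc-congˡ w γ≗sκ j) (lc-scale s κ w j))) (x⁻¹*[x*y]≡y s≢0 _)

  ∝⇒∈span-[lc] : ∀ {m n} {v : Vector K n} {π κ : Vector K m} (w : Fin m → Vector K n) →
                 v ≗ lc π w → π ∝ κ → v ∈span (lc κ w ∷ [])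
  ∝⇒∈span-[lc] {κ = κ} w v≗lc (s , _ , π≗sκ) = (λ _ → s) , λ j → begin
    _                    ≡⟨ v≗lc j ⟩
    lc _ w j             ≡⟨ lc-congˡ w π≗sκ j ⟩
    lc (s · κ) w j       ≡⟨ lc-scale s κ w j ⟩
    s * lc κ w j         ≡⟨ +-identityʳ _ ⟨
    s * lc κ w j + 0#    ∎

module ProjectiveSpace {q : ℕ} (F : FiniteField q) where
  open FiniteField F
  open LinearAlgebra F
  open PG3 F
  open Subspace using (basis)

  lincomb≗lc : ∀ {d} (c : Vector K d) (w : Fin d → V) → lincomb c w ≗ lc c w
  lincomb≗lc {zero} c w j = refl
  lincomb≗lc {suc d} c w j = cong (c zero * w zero j +_) (lincomb≗lc (tail c) (tail w) j)

  ∈ₛ⇒∈span : ∀ {d v} (S : Subspace d) → v ∈ₛ S → v ∈span basis S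
  ∈ₛ⇒∈span S (c , v≗) = c , λ j → trans (v≗ j) (lincomb≗lc c (basis S) j)

  ∈span⇒∈ₛ : ∀ {d v} (S : Subspace d) → v ∈span basis S → v ∈ₛ S
  ∈span⇒∈ₛ S (c , v≗) = c , λ j → trans (v≗ j) (sym (lincomb≗lc c (basis S) j))

  basis-independent : ∀ {d} (S : Subspace d) → Independent (basis S)
  basis-independent S c lc≡0 = Subspace.indep S c (λ j → trans (lincomb≗lc c (basis S) j) (lc≡0 j))

  ⊆ₛ-if-basis-∈span : ∀ {d e} (S : Subspace d) (T : Subspace e) → (∀ i → basis S i ∈span basis T) → S ⊆ₛ T
  ⊆ₛ-if-basis-∈span S T S⊆T v v∈S = ∈span⇒∈ₛ T (∈span-trans (∈ₛ⇒∈span S v∈S) S⊆T)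

  basis-∉span-if-⊈ : ∀ {d e} (S : Subspace d) (T : Subspace e) → ¬ S ⊆ₛ T → ∃ λ i → ¬ basis S i ∈span basis T
  basis-∉span-if-⊈ {d} S T S⊈T =
    ¬∀⟶∃¬ d _ (λ i → ∈span? (basis S i) (basis T)) (λ S⊆T → S⊈T (⊆ₛ-if-basis-∈span S T S⊆T))

  vec : Point → V
  vec p = basis p zero

  ⊆ₛ⇒vec-∈span : ∀ {d} (p : Point) (S : Subspace d) → p ⊆ₛ S → vec p ∈span basis S
  ⊆ₛ⇒vec-∈span p S p⊆S = ∈ₛ⇒∈span S (p⊆S (vec p) (∈span⇒∈ₛ p (∈span-member (basis p) zero)))

  points-≐ : ∀ {v} {x y : Point} → vec x ∈span (v ∷ []) → vec y ∈span (v ∷ []) → x ≐ y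
  points-≐ {v} {x} {y} x∈v y∈v = point-⊆ₛ x y x∈v y∈v , point-⊆ₛ y x y∈v x∈v
    where
    point-⊆ₛ : ∀ x y → vec x ∈span (v ∷ []) → vec y ∈span (v ∷ []) → x ⊆ₛ y
    point-⊆ₛ x y x∈v y∈v = ⊆ₛ-if-basis-∈span x y λ where
      zero → ∈span-trans {u = v ∷ []} {w = basis y} x∈v λ where
        zero → ∈span-[-]-sym {u = vec y} {v = v} (basis-independent y) y∈v

  Spans : Line → (Fin 2 → V) → Set
  Spans ℓ u = (∀ i → u i ∈span basis ℓ) × Independent u

  lines-≐ : ∀ {ℓ ℓ′ u} → Spans ℓ u → Spans ℓ′ u → ℓ ≐ ℓ′
  lines-≐ {ℓ} {ℓ′} spans spans′ = line-⊆ₛ ℓ ℓ′ spans spans′ , line-⊆ₛ ℓ′ ℓ spans′ spans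
    where
    line-⊆ₛ : ∀ ℓ ℓ′ {u} → Spans ℓ u → Spans ℓ′ u → ℓ ⊆ₛ ℓ′
    line-⊆ₛ ℓ ℓ′ {u} (u⊆ℓ , ind) (u⊆ℓ′ , _) v v∈ℓ =
      ∈span⇒∈ₛ ℓ′ (∈span-trans {u = u} {w = basis ℓ′} v∈u u⊆ℓ′)
      where
      v∈u = independent-span-⊇ {u = basis ℓ} {w = u} ind u⊆ℓ (∈ₛ⇒∈span ℓ v∈ℓ)

  line-meets-plane : (ℓ : Line) (b : Fin 3 → V) → ∃ λ γ → Nontrivial γ × lc γ b ∈span basis ℓ
  line-meets-plane ℓ b =
    dependent-∷-∷ {w = b} (basis-independent ℓ) (dependent 4 (basis ℓ zero ∷ basis ℓ (suc zero) ∷ b))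

module MarkedPoints {q : ℕ} (F : FiniteField q) (pts : List (PG3.Point F)) (P : PG3.Plane F) where
  open import Data.Nat using (_+_; _*_)
  open import Data.Nat.Properties using (+-monoʳ-≤; +-cancelʳ-≤; +-comm; *-identityʳ)
  open LinearAlgebra F
  open ProjectiveSpace F
  open PG3 F
  open Subspace using (basis)

  b : Fin 3 → V
  b = basis P

  q² : ℕ
  q² = q * q

  q^2≡q² : q ^ 2 ≡ q²
  q^2≡q² = cong (q *_) (*-identityʳ q)

  -- κ stands for the point of P with coordinate vector κ in the basis b
  Marked : Vector K 3 → Set
  Marked κ = Any (λ p → vec p ∈span (lc κ b ∷ [])) pts

  marked? : Decidable Marked
  marked? κ = Any.any? (λ p → ∈span? (vec p) (lc κ b ∷ [])) pts

  unmarked : List (Vector K 3)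
  unmarked = filter (∁? marked?) (normalized 3)

  length-normalized-3 : length (normalized 3) ≡ q² + (q + 1)
  length-normalized-3 = trans (length-normalized 2)
    (cong₂ _+_ q^2≡q² (trans (length-normalized 1) (cong (_+ 1) (*-identityʳ q))))

  marked-coordinates : ∀ {x} → Any (x ≐_) pts → x ⊆ₛ P →
                       Any (λ κ → vec x ∈span (lc κ b ∷ [])) (filter marked? (normalized 3))
  marked-coordinates {x} x∈pts x⊆P with ⊆ₛ⇒vec-∈span x P x⊆P
  ... | π , x≗lc =
    any-filter⁺ marked? (Any.map witness (normalize π (nontrivial-if-combination b (basis-independent x) x≗lc)))
    where
    witness : ∀ {κ} → π ∝ κ → vec x ∈span (lc κ b ∷ []) × Marked κ
    witness {κ} π∝κ = x∈κ , Any.map (λ {p} → p∈κ {p}) x∈pts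
      where
      x∈κ = ∝⇒∈span-[lc] b x≗lc π∝κ
      p∈κ : ∀ {p} → x ≐ p → vec p ∈span (lc κ b ∷ [])
      p∈κ {p} (_ , p⊆x) =
        ∈span-trans {u = vec x ∷ []} {w = lc κ b ∷ []} (⊆ₛ⇒vec-∈span p x p⊆x) λ { zero → x∈κ }

  length-unmarked : (∃ λ L → Distinct L × All (λ p → Any (p ≐_) pts) L × All (_⊆ₛ P) L × q + 1 ≤ length L) →
                    length unmarked ≤ q²
  length-unmarked (L , distinct , L⊆pts , L⊆P , q+1≤|L|) = +-cancelʳ-≤ (q + 1) _ _ (begin
    length unmarked + (q + 1)                                   ≤⟨ +-monoʳ-≤ (length unmarked) (≤-trans q+1≤|L| |L|≤|marked|) ⟩
    length unmarked + length (filter marked? (normalized 3))   ≡⟨ +-comm (length unmarked) _ ⟩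
    length (filter marked? (normalized 3)) + length unmarked   ≡⟨ length-filter+length-filter-∁ marked? (normalized 3) ⟩
    length (normalized 3)                                       ≡⟨ length-normalized-3 ⟩
    q² + (q + 1)                                                ∎)
    where
    open Data.Nat.Properties.≤-Reasoning
    |L|≤|marked| : length L ≤ length (filter marked? (normalized 3))
    |L|≤|marked| =
      distinct-witnessed⇒length≤ (λ x κ → vec x ∈span (lc κ b ∷ [])) (λ {x} {y} {κ} → points-≐ {lc κ b} {x} {y})
        distinct _ (All.zipWith (λ {x} (x∈pts , x⊆P) → marked-coordinates {x} x∈pts x⊆P) (L⊆pts , L⊆P))

  MeetsMarkedPoint : Line → Set
  MeetsMarkedPoint ℓ = Any (λ p → vec p ∈span basis ℓ × vec p ∈span b) pts

-- A line is recorded by an independent pair of its vectors, which determines it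
-- (lines-≐). Given a vector e outside P, the lines through a point p of pts that
-- we must count are recorded in a list of at most q² such pairs for each p.
module LineDescriptors {q : ℕ} (F : FiniteField q) (pts : List (PG3.Point F)) (P : PG3.Plane F)
                       (e : PG3.V F) (e∉P : ¬ LinearAlgebra._∈span_ F e (PG3.Subspace.basis P)) where
  open FiniteField F
  open LinearAlgebra F
  open ProjectiveSpace F
  open MarkedPoints F pts P
  open PG3 F
  open Subspace using (basis)
  open CommutativeRing commutativeRing using (+-identityʳ; zeroʳ; ring)
  open import Algebra.Properties.Ring ring using (-‿distribˡ-*)
  open ≡-Reasoning

  E : Fin 4 → V
  E = e ∷ b

  E-independent : Independent E
  E-independent = independent-∷ {v = e} {w = b} (basis-independent P) e∉P

  -- for p ∈ P with coordinates π: p together with e + lc β b, β ranging over a complement of π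
  insideBlock : (p : Point) → vec p ∈span b → List (Fin 2 → V)
  insideBlock p (π , p≗lc) =
    map (λ β → lc (1# ∷ β) E ∷ vec p ∷ []) (complement π (nontrivial-if-combination b (basis-independent p) p≗lc))

  outsideBlock : Point → List (Fin 2 → V)
  outsideBlock p = map (λ κ → vec p ∷ lc κ b ∷ []) unmarked

  block : Point → List (Fin 2 → V)
  block p with ∈span? (vec p) b
  ... | yes p∈P = insideBlock p p∈P
  ... | no _ = outsideBlock p

  length-block : length unmarked ≤ q² → ∀ p → length (block p) ≤ q²
  length-block |unmarked|≤q² p with ∈span? (vec p) b
  ... | yes (π , p≗lc) = ≤-reflexive (trans (length-map _ (complement π nt)) (trans (length-complement π nt) q^2≡q²))
    where nt = nontrivial-if-combination b (basis-independent p) p≗lc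
  ... | no _ = ≤-trans (≤-reflexive (length-map _ unmarked)) |unmarked|≤q²

  lc-[1∷β]-∉span : ∀ β → ¬ lc (1# ∷ β) E ∈span b
  lc-[1∷β]-∉span β (c , w≗lc) =
    1≢0 (lc-injective {w = E} E-independent {1# ∷ β} {0# ∷ c}
          (λ j → trans (w≗lc j) (sym (lc-tail (0# ∷ c) E refl j))) zero)

  inside-covers′ : ∀ ℓ p {u} (p∈P : vec p ∈span b) → vec p ∈span basis ℓ →
                   u ∈span basis ℓ → ¬ u ∈span b → u ∈span E → Any (Spans ℓ) (insideBlock p p∈P)
  inside-covers′ ℓ p {u} (π , p≗lc) p∈ℓ u∈ℓ u∉P (γ , u≗lc) with γ zero ≟ 0#
  ... | yes γ₀≡0 = ⊥-elim (u∉P (tail γ , λ j → trans (u≗lc j) (lc-tail γ E γ₀≡0 j)))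
  ... | no γ₀≢0 = map⁺ (Any.map spans (proj₂ (complement-covers π nt (g · tail γ))))
    where
    nt = nontrivial-if-combination b (basis-independent p) p≗lc
    g = γ₀≢0 ⁻¹
    t = proj₁ (complement-covers π nt (g · tail γ))
    spans : ∀ {β} → g · tail γ ≗ (λ j → β j + t * π j) → Spans ℓ (lc (1# ∷ β) E ∷ vec p ∷ [])
    spans {β} gγ≗β+tπ = members , independent-pair {b = b} (lc-[1∷β]-∉span β) (π , p≗lc) (basis-independent p)
      where
      coefficients : ∀ k → g * γ k + - t * (0# ∷ π) k ≡ (1# ∷ β) k
      coefficients zero = trans (cong₂ _+_ (x⁻¹*x≡1 γ₀≢0) (zeroʳ (- t))) (+-identityʳ 1#)
      coefficients (suc k) = begin
        g * γ (suc k) + - t * π k        ≡⟨ cong₂ _+_ (sym (gγ≗β+tπ k)) (-‿distribˡ-* t (π k)) ⟨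
        β k + t * π k + - (t * π k)      ≡⟨ x+y-y≡x (β k) (t * π k) ⟩
        β k                              ∎
      w≗gu-tp : lc (1# ∷ β) E ≗ (λ j → g * u j + - t * vec p j)
      w≗gu-tp j = begin
        lc (1# ∷ β) E j                                 ≡⟨ lc-congˡ E coefficients j ⟨
        lc (λ k → g * γ k + - t * (0# ∷ π) k) E j       ≡⟨ lc-+ (g · γ) (- t · (0# ∷ π)) E j ⟩
        lc (g · γ) E j + lc (- t · (0# ∷ π)) E j        ≡⟨ cong₂ _+_ (lc-scale g γ E j) (lc-scale (- t) (0# ∷ π) E j) ⟩
        g * lc γ E j + - t * lc (0# ∷ π) E j            ≡⟨ cong₂ (λ x y → g * x + - t * y) (sym (u≗lc j))
                                                                  (trans (lc-tail (0# ∷ π) E refl j) (sym (p≗lc j))) ⟩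
        g * u j + - t * vec p j                         ∎
      gu-tp∈ℓ : (λ j → g * u j + - t * vec p j) ∈span basis ℓ
      gu-tp∈ℓ = ∈span-+ {w = basis ℓ} (∈span-scale {w = basis ℓ} g u∈ℓ) (∈span-scale {w = basis ℓ} (- t) p∈ℓ)
      members : ∀ k → (lc (1# ∷ β) E ∷ vec p ∷ []) k ∈span basis ℓ
      members zero = ∈span-resp-≗ {w = basis ℓ} (λ j → sym (w≗gu-tp j)) gu-tp∈ℓ
      members (suc zero) = p∈ℓ

  inside-covers : ∀ ℓ p (p∈P : vec p ∈span b) → vec p ∈span basis ℓ → ¬ ℓ ⊆ₛ P →
                  Any (Spans ℓ) (insideBlock p p∈P)
  inside-covers ℓ p p∈P p∈ℓ ℓ⊈P =
    let i , u∉P = basis-∉span-if-⊈ ℓ P ℓ⊈P in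
    inside-covers′ ℓ p p∈P p∈ℓ (∈span-member (basis ℓ) i) u∉P (independent-spans {w = E} E-independent (basis ℓ i))

  outside-covers′ : ∀ ℓ p → ¬ vec p ∈span b → vec p ∈span basis ℓ → ¬ MeetsMarkedPoint ℓ →
                    (∃ λ γ → Nontrivial γ × lc γ b ∈span basis ℓ) → Any (Spans ℓ) (outsideBlock p)
  outside-covers′ ℓ p p∉P p∈ℓ no-meet (γ , nt , γ∈ℓ) =
    map⁺ (any-filter⁺ (∁? marked?) (Any.map spans-unmarked (normalize γ nt)))
    where
    spans-unmarked : ∀ {κ} → γ ∝ κ → Spans ℓ (vec p ∷ lc κ b ∷ []) × ¬ Marked κ
    spans-unmarked {κ} γ∝κ = (members , independent) , unmarked-κ
      where
      κ∈ℓ : lc κ b ∈span basis ℓ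
      κ∈ℓ = ∝⇒lc-∈span {w = b} {u = basis ℓ} γ∝κ γ∈ℓ
      κ∈P : lc κ b ∈span b
      κ∈P = κ , λ _ → refl
      members : ∀ k → (vec p ∷ lc κ b ∷ []) k ∈span basis ℓ
      members zero = p∈ℓ
      members (suc zero) = κ∈ℓ
      independent : Independent (vec p ∷ lc κ b ∷ [])
      independent = independent-pair {b = b} p∉P κ∈P (independent-lc {w = b} (basis-independent P) (∝-nontrivial γ∝κ nt))
      unmarked-κ : ¬ Marked κ
      unmarked-κ marked = no-meet (Any.map (λ {p′} → meets {p′}) marked)
        where
        meets : ∀ {p′} → vec p′ ∈span (lc κ b ∷ []) → vec p′ ∈span basis ℓ × vec p′ ∈span b
        meets p′∈κ = ∈span-trans {u = lc κ b ∷ []} {w = basis ℓ} p′∈κ (λ { zero → κ∈ℓ })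
                   , ∈span-trans {u = lc κ b ∷ []} {w = b} p′∈κ (λ { zero → κ∈P })

  block-covers : ∀ ℓ p → vec p ∈span basis ℓ → ¬ ℓ ⊆ₛ P → vec p ∈span b ⊎ ¬ MeetsMarkedPoint ℓ →
                 Any (Spans ℓ) (block p)
  block-covers ℓ p p∈ℓ ℓ⊈P p∈P⊎no-meet with ∈span? (vec p) b | p∈P⊎no-meet
  ... | yes p∈P | _ = inside-covers ℓ p p∈P p∈ℓ ℓ⊈P
  ... | no p∉P | inj₁ p∈P = ⊥-elim (p∉P p∈P)
  ... | no p∉P | inj₂ no-meet = outside-covers′ ℓ p p∉P p∈ℓ no-meet (line-meets-plane ℓ b)

  line-covered : ∀ ℓ → ¬ ℓ ⊆ₛ P → Any (_⊆ₛ ℓ) pts → Any (Spans ℓ) (concatMap block pts)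
  line-covered ℓ ℓ⊈P through-pts with Any.any? (λ p → ∈span? (vec p) (basis ℓ) ×-dec ∈span? (vec p) b) pts
  ... | yes meets =
    concatMap⁺ block (Any.map (λ {p} (p∈ℓ , p∈P) → block-covers ℓ p p∈ℓ ℓ⊈P (inj₁ p∈P)) meets)
  ... | no no-meet =
    concatMap⁺ block (Any.map (λ {p} p⊆ℓ → block-covers ℓ p (⊆ₛ⇒vec-∈span p ℓ p⊆ℓ) ℓ⊈P (inj₂ no-meet)) through-pts)

open import Data.Nat using (_+_; _*_)
open import Data.Nat.Properties using (*-assoc; *-identityʳ)

lines-through-pts-bound : ∀ {q} (F : FiniteField q) (pts : List (PG3.Point F)) (P : PG3.Plane F) →
  length (MarkedPoints.unmarked F pts P) ≤ q * q →
  ∀ (Ls : List (PG3.Line F)) → PG3.Distinct F Ls →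
  All (λ ℓ → ¬ (PG3._⊆ₛ_ F ℓ P) × Any (λ p → PG3._⊆ₛ_ F p ℓ) pts) Ls →
  length Ls ≤ length pts * (q * q)
lines-through-pts-bound F pts P |unmarked|≤q² List.[] _ _ = z≤n
lines-through-pts-bound F pts P |unmarked|≤q² (ℓ List.∷ _) distinct through@((ℓ⊈P , _) All.∷ _) =
  ≤-trans (distinct-witnessed⇒length≤ Spans (λ {ℓ} {ℓ′} {u} → lines-≐ {ℓ} {ℓ′} {u}) distinct (concatMap block pts)
            (All.map (λ {ℓ} (ℓ⊈P , through-pts) → line-covered ℓ ℓ⊈P through-pts) through))
          (length-concatMap-≤ block (length-block |unmarked|≤q²) pts)
  where
  open ProjectiveSpace F
  outside = basis-∉span-if-⊈ ℓ P ℓ⊈P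
  open LineDescriptors F pts P (PG3.Subspace.basis ℓ (proj₁ outside)) (proj₂ outside)

mainTheorem9 : ∀ (q : ℕ) (F : FiniteField q) (k : ℕ)
    (pts : List (PG3.Point F)) (pls : List (PG3.Plane F)) →
    PG3.Distinct F pts → length pts ≡ k * q →
    PG3.Distinct F pls → length pls + k * q ≡ q * (q + 1) →
    PG3.IsCover F pts pls →
    (P : PG3.Plane F) →
    (∃ λ (L : List (PG3.Point F)) → PG3.Distinct F L
        × All (λ p → Any (PG3._≐_ F p) pts) L
        × All (λ p → PG3._⊆ₛ_ F p P) L
        × q + 1 ≤ length L) →
    ∀ (Ls : List (PG3.Line F)) → PG3.Distinct F Ls →
    All (λ ℓ → ¬ (PG3._⊆ₛ_ F ℓ P) × Any (λ p → PG3._⊆ₛ_ F p ℓ) pts) Ls →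
    length Ls ≤ k * q ^ 3
mainTheorem9 q F k pts _ _ |pts|≡kq _ _ _ P points-in-P Ls distinct through = begin
  length Ls              ≤⟨ lines-through-pts-bound F pts P |unmarked|≤q² Ls distinct through ⟩
  length pts * (q * q)   ≡⟨ cong (_* (q * q)) |pts|≡kq ⟩
  k * q * (q * q)        ≡⟨ *-assoc k q (q * q) ⟩
  k * (q * (q * q))      ≡⟨ cong (λ x → k * (q * (q * x))) (*-identityʳ q) ⟨
  k * q ^ 3              ∎
  where
  open Data.Nat.Properties.≤-Reasoning
  |unmarked|≤q² = MarkedPoints.length-unmarked F pts P points-in-P
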